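{- Let $\mathcal{C}^{\mathbf{pre}}_{\mathbf{all}}$ be the class of all prestandard frames and $\mathcal{C}^{\mathbf{sta}}_{\mathbf{all}}$ the class of all standard frames. Then $\mathtt{Log}(\mathcal{C}^{\mathbf{pre}}_{\mathbf{all}})=\mathtt{Log}(\mathcal{C}^{\mathbf{sta}}_{\mathbf{all}})$. Here a frame is prestandard if $R(\alpha\cup\beta)\subseteq R(\alpha)\cap R(\beta)$ for all groups $\alpha,\beta$, and standard if $R(\alpha\cup\beta)=R(\alpha)\cap R(\beta)$ for all groups $\alpha,\beta$.
   Context: **Language.** Let $\mathbf{At}$ be a countably infinite set of atoms and let $\mathbf{Ag}$ be a finite set of agents. A group is a nonempty subset of $\mathbf{Ag}$. Formulas are generated by $$A ::= p \mid (A\rightarrow A) \mid \top \mid \bot \mid (A\vee A) \mid (A\wedge A) \mid [\alpha]A \mid \langle\alpha\rangle A.$$ **Frames.** A frame is a triple $(W,\leq,R)$ where $W$ is a nonempty set, $\leq$ is a preorder on $W$, and $R$ assigns to each group $\alpha$ a binary relation $R(\alpha)$ on $W$. For binary relations $S,T$, write $s\,(S\circ T)\,t$ iff there is $u$ with $sSu$ and $uTt$. Write $\geq$ for the converse of $\leq$. **Models and satisfaction.** A valuation is a map $V:\mathbf{At}\to\wp(W)$ with each $V(p)$ upward closed under $\leq$. Satisfaction in a model $(W,\leq,R,V)$ is defined as follows: - $s\models p$ iff $s\in V(p)$; - $s\models A\rightarrow B$ iff for all $t\geq s$, either $t\not\models A$ or $t\models B$; - $s\models\top$, and $s\not\models\bot$;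 - $\vee$ and $\wedge$ are interpreted pointwise; - $s\models[\alpha]A$ iff for all $t$ with $s\,(\leq\circ R(\alpha))\,t$, $t\models A$; - $s\models\langle\alpha\rangle A$ iff there is $t$ with $s\,(\geq\circ R(\alpha))\,t$ and $t\models A$. A formula is valid in a frame if it is satisfied at every state of every model based on that frame. For a class $\mathcal{C}$ of frames, $\mathtt{Log}(\mathcal{C})$ is the set of formulas valid in every frame in $\mathcal{C}$. -}

module Defs where

open import Level using (Level; suc; _⊔_)
open import Data.Nat using (ℕ)
open import Data.Fin using (Fin)
open import Data.Fin.Subset using (Subset; Nonempty; _∪_)
open import Data.Fin.Subset.Properties using (p⊆p∪q)
open import Data.Product using (Σ; _×_; _,_; proj₁; proj₂)
open import Data.Unit.Polymorphic using (⊤)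
open import Data.Empty.Polymorphic using (⊥)
open import Data.Sum using (_⊎_)

Atom : Set
Atom = ℕ

Group : ℕ → Set
Group n = Σ (Subset n) Nonempty

_∪ᴳ_ : ∀ {n} → Group n → Group n → Group n
(p , (i , i∈p)) ∪ᴳ (q , _) = (p ∪ q) , (i , p⊆p∪q q i∈p)

data Form (n : ℕ) : Set where
  atom : Atom → Form n
  _⇒_  : Form n → Form n → Form n
  ⊤ᶠ   : Form n
  ⊥ᶠ   : Form n
  _∨ᶠ_ : Form n → Form n → Form n
  _∧ᶠ_ : Form n → Form n → Form n
  box  : Group n → Form n → Form n
  dia  : Group n → Form n → Form n

record Frame (n : ℕ) (ℓ : Level) : Set (suc ℓ) where
  field
    W      : Set ℓ
    inhab  : W
    _≤_    : W → W → Set ℓ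
    ≤-refl : ∀ {s} → s ≤ s
    ≤-trans : ∀ {s t u} → s ≤ t → t ≤ u → s ≤ u
    R      : Group n → W → W → Set ℓ

module _ {n : ℕ} {ℓ : Level} where

  _⊆ᴿ_ : {W : Set ℓ} → (W → W → Set ℓ) → (W → W → Set ℓ) → Set ℓ
  S ⊆ᴿ T = ∀ s t → S s t → T s t

  _∩ᴿ_ : {W : Set ℓ} → (W → W → Set ℓ) → (W → W → Set ℓ) → (W → W → Set ℓ)
  (S ∩ᴿ T) s t = S s t × T s t

  Prestandard : Frame n ℓ → Set ℓ
  Prestandard F = ∀ (α β : Group n) → R (α ∪ᴳ β) ⊆ᴿ (R α ∩ᴿ R β)
    where open Frame F

  Standard : Frame n ℓ → Set ℓ
  Standard F = ∀ (α β : Group n) →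
    (R (α ∪ᴳ β) ⊆ᴿ (R α ∩ᴿ R β)) × ((R α ∩ᴿ R β) ⊆ᴿ R (α ∪ᴳ β))
    where open Frame F

  record Valuation (F : Frame n ℓ) : Set (suc ℓ) where
    open Frame F
    field
      V  : Atom → W → Set ℓ
      up : ∀ p {s t} → s ≤ t → V p s → V p t

  Sat : (F : Frame n ℓ) → Valuation F → Frame.W F → Form n → Set ℓ
  Sat F V s (atom p) = Valuation.V V p s
  Sat F V s (A ⇒ B) = ∀ t → Frame._≤_ F s t → Sat F V t A → Sat F V t B
  Sat F V s ⊤ᶠ = ⊤
  Sat F V s ⊥ᶠ = ⊥
  Sat F V s (A ∨ᶠ B) = Sat F V s A ⊎ Sat F V s B
  Sat F V s (A ∧ᶠ B) = Sat F V s A × Sat F V s B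
  Sat F V s (box α A) = ∀ u t → Frame._≤_ F s u → Frame.R F α u t → Sat F V t A
  Sat F V s (dia α A) =
    Σ (Frame.W F) λ u → Σ (Frame.W F) λ t →
      Frame._≤_ F u s × Frame.R F α u t × Sat F V t A

  ValidIn : Frame n ℓ → Form n → Set (suc ℓ)
  ValidIn F A = (V : Valuation F) → (s : Frame.W F) → Sat F V s A

  InLogPre : Form n → Set (suc ℓ)
  InLogPre A = (F : Frame n ℓ) → Prestandard F → ValidIn F A

  InLogSta : Form n → Set (suc ℓ)
  InLogSta A = (F : Frame n ℓ) → Standard F → ValidIn F A

module Submission where

open import Defs
open import Level using (Level; Lift; lift; lower)
open import Data.Nat using (ℕ)
open import Data.Product using (_×_; Σ; _,_; proj₁; proj₂)
import Data.Product as Product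
import Data.Sum as Sum
open import Data.Fin.Subset using (Subset; _⊆_; _∪_; ⊥)
open import Data.Fin.Subset.Properties using (⊆-refl; ⊆-antisym; p⊆p∪q; q⊆p∪q; x∈p∪q⁻)
open import Data.Vec.Properties.WithK using ([]=-irrelevant)
open import Relation.Binary.PropositionalEquality using (_≡_; refl; sym; cong; subst)

-- A prestandard frame is one whose relation R α can only shrink as α grows.  Unravel it:
-- pair each state with a set S of agents and let an α-step into (t , S) exist iff α ⊆ S
-- and t is R γ-reachable for every group γ ⊆ S.  Since α ∪ β ⊆ S iff α ⊆ S and β ⊆ S,
-- the unravelled frame is standard, and by antitonicity of R its projection onto the
-- original frame is a bounded morphism, so both frames validate the same formulas.

∪-lub : ∀ {n} {p q r : Subset n} → p ⊆ r → q ⊆ r → p ∪ q ⊆ r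
∪-lub {p = p} {q} p⊆r q⊆r x∈p∪q = Sum.[ p⊆r , q⊆r ] (x∈p∪q⁻ p q x∈p∪q)

q⊆p⇒p∪ᴳq≡p : ∀ {n} {α β : Group n} → proj₁ β ⊆ proj₁ α → α ∪ᴳ β ≡ α
q⊆p⇒p∪ᴳq≡p {α = p , i , i∈p} {q , _} q⊆p
  with p ∪ q | ⊆-antisym (∪-lub ⊆-refl q⊆p) (p⊆p∪q q) | p⊆p∪q q i∈p
... | _ | refl | i∈p∪q = cong (λ i∈ → p , i , i∈) ([]=-irrelevant i∈p∪q i∈p)

Standard⇒Prestandard : ∀ {n ℓ} (F : Frame n ℓ) → Standard F → Prestandard F
Standard⇒Prestandard F standard α β = proj₁ (standard α β)

module _ {n ℓ} (F : Frame n ℓ) where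
  open Frame F

  Prestandard⇒R-antitone : Prestandard F →
    ∀ (α γ : Group n) → proj₁ γ ⊆ proj₁ α → ∀ s t → R α s t → R γ s t
  Prestandard⇒R-antitone prestandard α γ γ⊆α s t sRαt =
    proj₁ (prestandard γ α s t (proj₂ (prestandard α δ s t sRα∪δt)))
    where
    -- γ ∪ᴳ α is not literally α (it carries γ's nonemptiness witness), but α ∪ᴳ (γ ∪ᴳ α) is.
    δ : Group n
    δ = γ ∪ᴳ α
    sRα∪δt : R (α ∪ᴳ δ) s t
    sRα∪δt = subst (λ g → R g s t) (sym (q⊆p⇒p∪ᴳq≡p {α = α} {δ} (∪-lub γ⊆α ⊆-refl))) sRαt

record BoundedMorphism {n ℓ} (F′ F : Frame n ℓ) : Set ℓ where
  private
    module F′ = Frame F′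
    module F = Frame F
  field
    f       : F′.W → F.W
    ≤-forth : ∀ {a b} → a F′.≤ b → f a F.≤ f b
    R-forth : ∀ {α a b} → F′.R α a b → F.R α (f a) (f b)
    ≤-back  : ∀ {a t} → f a F.≤ t → Σ F′.W λ b → a F′.≤ b × f b ≡ t
    ≤R-back : ∀ {α a u t} → f a F.≤ u → F.R α u t →
              Σ F′.W λ u′ → Σ F′.W λ t′ → a F′.≤ u′ × F′.R α u′ t′ × f t′ ≡ t
    ≥R-back : ∀ {α a u t} → u F.≤ f a → F.R α u t →
              Σ F′.W λ u′ → Σ F′.W λ t′ → u′ F′.≤ a × F′.R α u′ t′ × f t′ ≡ t

module _ {n ℓ} {F′ F : Frame n ℓ} (φ : BoundedMorphism F′ F) where
  open BoundedMorphism φ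

  comap : Valuation F → Valuation F′
  comap V = record { V = λ p a → Valuation.V V p (f a) ; up = λ p a≤b → Valuation.up V p (≤-forth a≤b) }

  module _ (V : Valuation F) where
    mutual
      Sat-preserve : ∀ A {a} → Sat F′ (comap V) a A → Sat F V (f a) A
      Sat-preserve (atom p) x = x
      Sat-preserve (A ⇒ B) h t fa≤t x with ≤-back fa≤t
      ... | b , a≤b , refl = Sat-preserve B (h b a≤b (Sat-reflect A x))
      Sat-preserve ⊤ᶠ x = x
      Sat-preserve ⊥ᶠ ()
      Sat-preserve (A ∨ᶠ B) = Sum.map (Sat-preserve A) (Sat-preserve B)
      Sat-preserve (A ∧ᶠ B) = Product.map (Sat-preserve A) (Sat-preserve B)
      Sat-preserve (box α A) h u t fa≤u uRt with ≤R-back fa≤u uRt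
      ... | u′ , t′ , a≤u′ , u′Rt′ , refl = Sat-preserve A (h u′ t′ a≤u′ u′Rt′)
      Sat-preserve (dia α A) (u′ , t′ , u′≤a , u′Rt′ , x) =
        f u′ , f t′ , ≤-forth u′≤a , R-forth u′Rt′ , Sat-preserve A x

      Sat-reflect : ∀ A {a} → Sat F V (f a) A → Sat F′ (comap V) a A
      Sat-reflect (atom p) x = x
      Sat-reflect (A ⇒ B) h b a≤b x = Sat-reflect B (h (f b) (≤-forth a≤b) (Sat-preserve A x))
      Sat-reflect ⊤ᶠ x = x
      Sat-reflect ⊥ᶠ ()
      Sat-reflect (A ∨ᶠ B) = Sum.map (Sat-reflect A) (Sat-reflect B)
      Sat-reflect (A ∧ᶠ B) = Product.map (Sat-reflect A) (Sat-reflect B)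
      Sat-reflect (box α A) h u′ t′ a≤u′ u′Rt′ =
        Sat-reflect A (h (f u′) (f t′) (≤-forth a≤u′) (R-forth u′Rt′))
      Sat-reflect (dia α A) (u , t , u≤fa , uRt , x) with ≥R-back u≤fa uRt
      ... | u′ , t′ , u′≤a , u′Rt′ , refl = u′ , t′ , u′≤a , u′Rt′ , Sat-reflect A x

  ValidIn-reflect : (∀ s → Σ (Frame.W F′) λ a → f a ≡ s) → ∀ A → ValidIn F′ A → ValidIn F A
  ValidIn-reflect surjective A valid V s with surjective s
  ... | a , refl = Sat-preserve V A (valid (comap V) a)

module Unravelling {n ℓ} (F : Frame n ℓ) (prestandard : Prestandard F) where
  open Frame F

  R⁺ : Group n → W × Lift ℓ (Subset n) → W × Lift ℓ (Subset n) → Set ℓ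
  R⁺ α (s , _) (t , lift S) = Lift ℓ (proj₁ α ⊆ S) × (∀ (γ : Group n) → proj₁ γ ⊆ S → R γ s t)

  F⁺ : Frame n ℓ
  F⁺ = record
    { W       = W × Lift ℓ (Subset n)
    ; inhab   = inhab , lift ⊥
    ; _≤_     = λ a b → proj₁ a ≤ proj₁ b
    ; ≤-refl  = ≤-refl
    ; ≤-trans = ≤-trans
    ; R       = R⁺
    }

  F⁺-standard : Standard F⁺
  F⁺-standard α β = R⁺-∪ᴳ⊆∩ , R⁺-∩⊆∪ᴳ
    where
    R⁺-∪ᴳ⊆∩ : ∀ a b → R⁺ (α ∪ᴳ β) a b → R⁺ α a b × R⁺ β a b
    R⁺-∪ᴳ⊆∩ a b (lift α∪β⊆S , reach) =
      (lift (λ x∈α → α∪β⊆S (p⊆p∪q _ x∈α)) , reach) , (lift (λ x∈β → α∪β⊆S (q⊆p∪q _ _ x∈β)) , reach)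
    R⁺-∩⊆∪ᴳ : ∀ a b → R⁺ α a b × R⁺ β a b → R⁺ (α ∪ᴳ β) a b
    R⁺-∩⊆∪ᴳ a b ((lift α⊆S , reach) , (lift β⊆S , _)) = lift (∪-lub α⊆S β⊆S) , reach

  R⁺-from-R : ∀ {α s t} (S : Lift ℓ (Subset n)) → R α s t → R⁺ α (s , S) (t , lift (proj₁ α))
  R⁺-from-R {α} S sRt = lift ⊆-refl , λ γ γ⊆α → Prestandard⇒R-antitone F prestandard α γ γ⊆α _ _ sRt

  proj₁-bounded : BoundedMorphism F⁺ F
  proj₁-bounded = record
    { f       = proj₁
    ; ≤-forth = λ s≤t → s≤t
    ; R-forth = λ { {α} (lift α⊆S , reach) → reach α α⊆S }
    ; ≤-back  = λ { {s , S} {t} s≤t → (t , S) , s≤t , refl }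
    ; ≤R-back = λ { {α} {s , S} {u} {t} s≤u uRt → (u , S) , (t , lift (proj₁ α)) , s≤u , R⁺-from-R S uRt , refl }
    ; ≥R-back = λ { {α} {s , S} {u} {t} u≤s uRt → (u , S) , (t , lift (proj₁ α)) , u≤s , R⁺-from-R S uRt , refl }
    }

  proj₁-surjective : ∀ s → Σ (Frame.W F⁺) λ a → proj₁ a ≡ s
  proj₁-surjective s = (s , lift ⊥) , refl

proposition8 : (n : ℕ) (ℓ : Level) (A : Form n) →
    (InLogPre {n} {ℓ} A → InLogSta {n} {ℓ} A) × (InLogSta {n} {ℓ} A → InLogPre {n} {ℓ} A)
proposition8 n ℓ A = pre⇒sta , sta⇒pre
  where
  pre⇒sta : InLogPre A → InLogSta A
  pre⇒sta valid F standard = valid F (Standard⇒Prestandard F standard)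

  sta⇒pre : InLogSta A → InLogPre A
  sta⇒pre valid F prestandard =
    ValidIn-reflect proj₁-bounded proj₁-surjective A (valid F⁺ F⁺-standard)
    where open Unravelling F prestandard
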